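{- For every real $R\ge 2$, the set $\{(x,y)\in\mathbb{N}^{+}\times\mathbb{N}^{+}:\ \gcd(x,y)=1,\ x+y\le R\}$ is a corona.
   Context: Let $\mathbb{N}^+=\{1,2,3,\dots\}$ and $\underline{\mathbb{Q}}^{+}=\{(x,y)\in\mathbb{N}^+\times\mathbb{N}^+:\gcd(x,y)=1\}$; put $\underline{0}=(1,0)$ and $\underline{\infty}=(0,1)$. Points of $\underline{\mathbb{Q}}^{+}\cup\{\underline 0,\underline\infty\}$ are totally ordered by $(x,y)<(x',y')$ iff $y/x<y'/x'$. Sums and integer multiples of points are taken coordinatewise in $\mathbb{Z}^2$. Every $v\in\underline{\mathbb{Q}}^{+}$ can be written uniquely as $v=v_-+v_+$ with $v_\pm=(x_\pm,y_\pm)\in\underline{\mathbb{Q}}^{+}\cup\{\underline0,\underline\infty\}$ and $x_-y_+-y_-x_+=1$. The set $\underline{\mathbb{Q}}^{+}$ is a rooted binary tree (Stern–Brocot tree) with root $(1,1)$, in which the two children of $v$ are $v+v_+$ and $v+v_-$; each $v\ne(1,1)$ has a unique parent $M(v)$. Write $v'\lhd v$ iff $v'=M^k(v)$ for some $k\ge0$. A $\lhd$-set is a finite subset $c\subseteq\underline{\mathbb{Q}}^{+}$ such that $v\in c$ and $v'\lhd v$ imply $v'\in c$. For a $\lhd$-set $c$ with $m-1$ elements write $c=\{c_1<\dots<c_{m-1}\}$, $c_0=\underline0$, $c_m=\underline\infty$. For finite $c\subseteq\underline{\mathbb{Q}}^{+}$ let $\Phi c=\{v\in c:\ v+v_+\in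 c\text{ and }v+v_-\in c\}$ and $c^{\max}=\{v\in c:\ v+v_+\notin c\text{ and }v+v_-\notin c\}$. A $\star$-set is a $\lhd$-set $c=\{c_1<\dots<c_{m-1}\}$ such that for each $1\le i\le m-1$: $c_i\in c^{\max}$, or $c_i\in\Phi c$, or $c_i-c_{i-1}=c_{i+1}-c_i$. A corona is a $\lhd$-set $c$ such that $\Phi^n c$ is a $\star$-set for every $n\ge0$ (the empty set counts as a $\lhd$-set and a $\star$-set). -}

module Defs where

open import Data.Nat using (ℕ; zero; suc; _+_; _*_; _≤_; _<_)
open import Data.Nat.GCD using (gcd)
open import Data.Product using (Σ; _×_; _,_; proj₁; proj₂)
open import Data.Sum using (_⊎_)
open import Data.List using (List)
open import Data.List.Membership.Propositional using (_∈_)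
open import Relation.Nullary using (¬_)
open import Relation.Binary.PropositionalEquality using (_≡_)

-- Points of ℕ⁺×ℕ⁺ together with 0̲ = (1,0) and ∞̲ = (0,1) are all pairs of naturals.
Pt : Set
Pt = ℕ × ℕ

0̲ : Pt
0̲ = (1 , 0)

∞̲ : Pt
∞̲ = (0 , 1)

Qpos : Pt → Set
Qpos (x , y) = (1 ≤ x) × (1 ≤ y) × (gcd x y ≡ 1)

Qext : Pt → Set
Qext v = Qpos v ⊎ (v ≡ 0̲) ⊎ (v ≡ ∞̲)

-- (x,y) < (x',y') iff y/x < y'/x', i.e. y*x' < y'*x (cross-multiplied; valid for 0̲, ∞̲ too)
_≺_ : Pt → Pt → Set
(x , y) ≺ (x' , y') = y * x' < y' * x

_⊕_ : Pt → Pt → Pt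
(x , y) ⊕ (x' , y') = (x + x' , y + y')

-- Split v a b : v = a + b with a = v₋, b = v₊, i.e. a,b ∈ Q̲⁺∪{0̲,∞̲} and x₋y₊ − y₋x₊ = 1
Split : Pt → Pt → Pt → Set
Split v a b = Qext a × Qext b × (v ≡ a ⊕ b)
              × (proj₁ a * proj₂ b ≡ 1 + proj₂ a * proj₁ b)

-- w is a child of v in the Stern–Brocot tree (w = v + v₊ or w = v + v₋)
Child : Pt → Pt → Set
Child v w = Σ Pt λ a → Σ Pt λ b → Split v a b × ((w ≡ v ⊕ b) ⊎ (w ≡ v ⊕ a))

data _⊲_ : Pt → Pt → Set where
  ⊲-refl : ∀ {v} → v ⊲ v
  ⊲-step : ∀ {v' u v} → v' ⊲ u → Child u v → v' ⊲ v

PSet : Set₁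
PSet = Pt → Set

Finite : PSet → Set
Finite c = Σ (List Pt) λ l → ∀ v → c v → v ∈ l

IsLhdSet : PSet → Set
IsLhdSet c = Finite c × (∀ v → c v → Qpos v) × (∀ v v' → c v → v' ⊲ v → c v')

Φ : PSet → PSet
Φ c v = c v × (∀ a b → Split v a b → c (v ⊕ b) × c (v ⊕ a))

Cmax : PSet → PSet
Cmax c v = c v × (∀ a b → Split v a b → ¬ c (v ⊕ b) × ¬ c (v ⊕ a))

Φ^ : ℕ → PSet → PSet
Φ^ zero c = c
Φ^ (suc n) c = Φ (Φ^ n c)

-- u = c_{i-1} when v = c_i (with c_0 = 0̲)
IsPred : PSet → Pt → Pt → Set
IsPred c u v = (c u ⊎ u ≡ 0̲) × u ≺ v × (∀ w → c w → ¬ (u ≺ w × w ≺ v))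

-- w = c_{i+1} when v = c_i (with c_m = ∞̲)
IsSucc : PSet → Pt → Pt → Set
IsSucc c v w = (c w ⊎ w ≡ ∞̲) × v ≺ w × (∀ u → c u → ¬ (v ≺ u × u ≺ w))

-- ⋆-set; c_i − c_{i−1} = c_{i+1} − c_i is written as 2c_i = c_{i−1} + c_{i+1}
IsStarSet : PSet → Set
IsStarSet c = IsLhdSet c ×
  (∀ v → c v → Cmax c v ⊎ Φ c v
     ⊎ (∀ u w → IsPred c u v → IsSucc c v w → v ⊕ v ≡ u ⊕ w))

IsCorona : PSet → Set
IsCorona c = IsLhdSet c × (∀ n → IsStarSet (Φ^ n c))

Ball : ℕ → PSet
Ball N (x , y) = Qpos (x , y) × (x + y ≤ N)

module Submission where

-- Every v ∈ Q̲⁺ splits uniquely as v = v₋ + v₊ into Farey neighbours, and the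
-- children of v split as (v₋ , v) and (v , v₊).  Hence membership of v in
-- Φⁿ (Ball N) depends only on the weights x + y of v₋ and v₊; this dependence
-- is the recursive predicate Fits, which is antitone because parents are
-- lighter than their children, and ⊲-closedness follows.  For the ⋆-condition
-- the only case needing work is when exactly one child of v survives, say
-- v + v₊.  A point strictly between Farey neighbours l and r has parents at
-- least as heavy as l and r, so nothing survives strictly between v₋ and v,
-- nor between v and v + v₊; the neighbours of v are therefore v₋ and v + v₊,
-- and v is their midpoint.

open import Data.Empty using (⊥-elim)
open import Data.List using (_∷_; []; upTo; cartesianProduct)
open import Data.List.Membership.Propositional.Properties using (∈-upTo⁺; ∈-cartesianProduct⁺)
open import Data.Nat using (ℕ; zero; suc; _+_; _*_; _≤_; _<_; z≤n; s≤s; _≤?_; _<?_)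
open import Data.Nat.Coprimality using (Coprime; gcd≡1⇒coprime; coprime⇒gcd≡1; coprime-+)
  renaming (sym to coprime-sym)
open import Data.Nat.Divisibility using (_∣_; ∣1⇒≡1; ∣m+n∣m⇒∣n; ∣m∣n⇒∣m+n; ∣m⇒∣m*n; m∣m*n; ∣-refl)
open import Data.Nat.GCD using (gcd)
open import Data.Nat.Properties
open import Algebra.Properties.CommutativeSemigroup +-commutativeSemigroup
  using () renaming (interchange to +-interchange)
open import Data.Nat.Tactic.RingSolver using (solve; solve-∀)
open import Data.Product using (Σ; ∃; _×_; _,_; proj₁; proj₂)
open import Data.Sum using (_⊎_; inj₁; inj₂)
open import Function using (_∘_; _⇔_; mk⇔; Equivalence)
open import Relation.Binary using (Tri; tri<; tri≈; tri>)
open import Relation.Binary.PropositionalEquality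
open import Relation.Nullary using (¬_; Dec; yes; no)
open import Relation.Nullary.Decidable using (_×-dec_; map′)

open import Defs

open Equivalence using (to; from)

weight : Pt → ℕ
weight (x , y) = x + y

infixr 25 _·_

_·_ : ℕ → Pt → Pt
k · (x , y) = (k * x , k * y)

_≼_ : Pt → Pt → Set
(x , y) ≼ (x' , y') = y * x' ≤ y' * x

Parallel : Pt → Pt → Set
Parallel (x , y) (x' , y') = y * x' ≡ y' * x

-- The determinant condition of Split, as a record so that a and b are
-- inferable from a proof of Adjacent a b.
record Adjacent (a b : Pt) : Set where
  constructor adjacent
  field det : proj₁ a * proj₂ b ≡ 1 + proj₂ a * proj₁ b

weight-⊕ : ∀ a b → weight (a ⊕ b) ≡ weight a + weight b
weight-⊕ (a₁ , a₂) (b₁ , b₂) = +-interchange a₁ b₁ a₂ b₂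

weight-· : ∀ k a → weight (k · a) ≡ k * weight a
weight-· k (x , y) = sym (*-distribˡ-+ k x y)

⊕-comm : ∀ a b → a ⊕ b ≡ b ⊕ a
⊕-comm (a₁ , a₂) (b₁ , b₂) = cong₂ _,_ (+-comm a₁ b₁) (+-comm a₂ b₂)

⊕-cancelˡ : ∀ a {b b'} → a ⊕ b ≡ a ⊕ b' → b ≡ b'
⊕-cancelˡ (a₁ , a₂) eq = cong₂ _,_ (+-cancelˡ-≡ a₁ _ _ (cong proj₁ eq)) (+-cancelˡ-≡ a₂ _ _ (cong proj₂ eq))

⊕-identityʳ : ∀ a → a ⊕ (0 , 0) ≡ a
⊕-identityʳ (x , y) = cong₂ _,_ (+-identityʳ x) (+-identityʳ y)

·-identityˡ : ∀ a → 1 · a ≡ a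
·-identityˡ (x , y) = cong₂ _,_ (*-identityˡ x) (*-identityˡ y)

⊕-equal-stepsʳ : ∀ {v a b} → v ≡ a ⊕ b → v ⊕ v ≡ a ⊕ (v ⊕ b)
⊕-equal-stepsʳ {a = a₁ , a₂} {b₁ , b₂} refl = cong₂ _,_ (steps a₁ b₁) (steps a₂ b₂)
  where
  steps : ∀ x y → x + y + (x + y) ≡ x + (x + y + y)
  steps = solve-∀

⊕-equal-stepsˡ : ∀ {v a b} → v ≡ a ⊕ b → v ⊕ v ≡ (v ⊕ a) ⊕ b
⊕-equal-stepsˡ {a = a₁ , a₂} {b₁ , b₂} refl = cong₂ _,_ (steps a₁ b₁) (steps a₂ b₂)
  where
  steps : ∀ x y → x + y + (x + y) ≡ x + y + x + y
  steps = solve-∀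

<⇒+suc≡ : ∀ {m n} → m < n → ∃ λ k → m + suc k ≡ n
<⇒+suc≡ {m} m<n with k , eq ← m≤n⇒∃[o]m+o≡n m<n = k , trans (+-suc m k) eq

≺-compare : ∀ v w → Tri (v ≺ w) (Parallel v w) (w ≺ v)
≺-compare (x , y) (x' , y') = <-cmp (y * x') (y' * x)

≺-or-≽ : ∀ v w → v ≺ w ⊎ w ≼ v
≺-or-≽ (x , y) (x' , y') with y * x' <? y' * x
... | yes v≺w = inj₁ v≺w
... | no v⊀w = inj₂ (≮⇒≥ v⊀w)

≺-trans : ∀ {u v w} → u ≺ v → v ≺ w → u ≺ w
≺-trans {zero , u₂} {v₁ , v₂} u≺v _ = ⊥-elim (n≮0 (subst (u₂ * v₁ <_) (*-zeroʳ v₂) u≺v))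
≺-trans {u₁@(suc _) , u₂} {v₁ , v₂} {w₁ , w₂} u≺v v≺w = *-cancelʳ-< v₁ _ _ (begin-strict
  u₂ * w₁ * v₁   ≡⟨ right-comm u₂ w₁ v₁ ⟩
  u₂ * v₁ * w₁   ≤⟨ *-monoˡ-≤ w₁ (<⇒≤ u≺v) ⟩
  v₂ * u₁ * w₁   ≡⟨ right-comm v₂ u₁ w₁ ⟩
  v₂ * w₁ * u₁   <⟨ *-monoˡ-< u₁ v≺w ⟩
  w₂ * v₁ * u₁   ≡⟨ right-comm w₂ v₁ u₁ ⟩
  w₂ * u₁ * v₁   ∎)
  where
  open ≤-Reasoning
  right-comm : ∀ x y z → x * y * z ≡ x * z * y
  right-comm = solve-∀

≺0̲-empty : ∀ u → ¬ u ≺ 0̲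
≺0̲-empty _ ()

∞̲≺-empty : ∀ w → ¬ ∞̲ ≺ w
∞̲≺-empty (w₁ , w₂) ∞̲≺w = n≮0 (subst (1 * w₁ <_) (*-zeroʳ w₂) ∞̲≺w)

Qext-horizontal : ∀ {m} → Qext m → proj₂ m ≡ 0 → m ≡ 0̲
Qext-horizontal (inj₁ (_ , 1≤m₂ , _)) m₂≡0 = ⊥-elim (<⇒≢ 1≤m₂ (sym m₂≡0))
Qext-horizontal (inj₂ (inj₁ m≡0̲)) _ = m≡0̲
Qext-horizontal (inj₂ (inj₂ refl)) ()

Qext-vertical : ∀ {m} → Qext m → proj₁ m ≡ 0 → m ≡ ∞̲
Qext-vertical (inj₁ (1≤m₁ , _ , _)) m₁≡0 = ⊥-elim (<⇒≢ 1≤m₁ (sym m₁≡0))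
Qext-vertical (inj₂ (inj₁ refl)) ()
Qext-vertical (inj₂ (inj₂ m≡∞̲)) _ = m≡∞̲

-- Farey neighbours

adjacent⇒≺ : ∀ {a b} → Adjacent a b → a ≺ b
adjacent⇒≺ {a₁ , _} {_ , b₂} (adjacent adj) = ≤-reflexive (sym (trans (*-comm b₂ a₁) adj))

adjacent⇒1≤ˡ : ∀ {a b} → Adjacent a b → 1 ≤ proj₁ a
adjacent⇒1≤ˡ {zero , _} (adjacent ())
adjacent⇒1≤ˡ {suc _ , _} _ = s≤s z≤n

adjacent⇒1≤ʳ : ∀ {a b} → Adjacent a b → 1 ≤ proj₂ b
adjacent⇒1≤ʳ {a₁ , _} {_ , zero} (adjacent adj) = ⊥-elim (0≢1+n (trans (sym (*-zeroʳ a₁)) adj))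
adjacent⇒1≤ʳ {_} {_ , suc _} _ = s≤s z≤n

adjacent⇒weightˡ>0 : ∀ {a b} → Adjacent a b → 0 < weight a
adjacent⇒weightˡ>0 {a₁ , a₂} adj = ≤-trans (adjacent⇒1≤ˡ adj) (m≤m+n a₁ a₂)

adjacent⇒weightʳ>0 : ∀ {a b} → Adjacent a b → 0 < weight b
adjacent⇒weightʳ>0 {b = b₁ , b₂} adj = ≤-trans (adjacent⇒1≤ʳ adj) (m≤n+m b₂ b₁)

adjacent⇒coprime : ∀ {u w} → Adjacent u w → Coprime (proj₁ u) (proj₂ u)
adjacent⇒coprime {u₁ , u₂} {w₁ , w₂} (adjacent adj) {d} (d∣u₁ , d∣u₂) =
  ∣1⇒≡1 (∣m+n∣m⇒∣n (subst (d ∣_) (trans adj (+-comm 1 _)) (∣m⇒∣m*n w₂ d∣u₁)) (∣m⇒∣m*n w₁ d∣u₂))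

adjacent-mediantˡ : ∀ {a b} → Adjacent a b → Adjacent a (a ⊕ b)
adjacent-mediantˡ {a₁ , a₂} {b₁ , b₂} (adjacent adj) = adjacent (begin
  a₁ * (a₂ + b₂)          ≡⟨ *-distribˡ-+ a₁ a₂ b₂ ⟩
  a₁ * a₂ + a₁ * b₂       ≡⟨ cong (a₁ * a₂ +_) adj ⟩
  a₁ * a₂ + (1 + a₂ * b₁) ≡⟨ solve (a₁ ∷ a₂ ∷ b₁ ∷ []) ⟩
  1 + a₂ * (a₁ + b₁)      ∎)
  where open ≡-Reasoning

adjacent-mediantʳ : ∀ {a b} → Adjacent a b → Adjacent (a ⊕ b) b
adjacent-mediantʳ {a₁ , a₂} {b₁ , b₂} (adjacent adj) = adjacent (begin
  (a₁ + b₁) * b₂          ≡⟨ *-distribʳ-+ b₂ a₁ b₁ ⟩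
  a₁ * b₂ + b₁ * b₂       ≡⟨ cong (_+ b₁ * b₂) adj ⟩
  1 + a₂ * b₁ + b₁ * b₂   ≡⟨ solve (a₂ ∷ b₁ ∷ b₂ ∷ []) ⟩
  1 + (a₂ + b₂) * b₁      ∎)
  where open ≡-Reasoning

mediant-Qpos : ∀ {a b} → Adjacent a b → Qpos (a ⊕ b)
mediant-Qpos {a₁ , _} {b₁ , b₂} adj =
    ≤-trans (adjacent⇒1≤ˡ adj) (m≤m+n a₁ b₁)
  , ≤-trans (adjacent⇒1≤ʳ adj) (m≤n+m b₂ _)
  , coprime⇒gcd≡1 (adjacent⇒coprime (adjacent-mediantʳ adj))

adjacent-multiple : ∀ {k a v} → Adjacent a v → Adjacent (k · a) v → k ≡ 1
adjacent-multiple {k} {a₁ , a₂} {v₁ , v₂} (adjacent adj) (adjacent adjₖ) = +-cancelʳ-≡ _ k 1 (begin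
  k + k * (a₂ * v₁)  ≡⟨ solve (k ∷ a₂ ∷ v₁ ∷ []) ⟩
  k * (1 + a₂ * v₁)  ≡⟨ cong (k *_) adj ⟨
  k * (a₁ * v₂)      ≡⟨ solve (k ∷ a₁ ∷ v₂ ∷ []) ⟩
  k * a₁ * v₂        ≡⟨ adjₖ ⟩
  1 + k * a₂ * v₁    ≡⟨ cong (1 +_) (*-assoc k a₂ v₁) ⟩
  1 + k * (a₂ * v₁)  ∎)
  where open ≡-Reasoning

primitive-multiple : ∀ k a → gcd (proj₁ (k · a)) (proj₂ (k · a)) ≡ 1 → k · a ≡ a
primitive-multiple k (x , y) g with refl ← gcd≡1⇒coprime g (m∣m*n {k} x , m∣m*n y) = ·-identityˡ (x , y)

-- For Farey neighbours a and b, any w equals Q · a ⊕ P · b where P and Q are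
-- the determinants of (a , w) and (w , b); they are natural numbers exactly
-- when a ≼ w ≼ b.
farey-decomposition : ∀ {a b w P Q} → Adjacent a b →
                      proj₂ a * proj₁ w + P ≡ proj₂ w * proj₁ a →
                      proj₂ w * proj₁ b + Q ≡ proj₂ b * proj₁ w →
                      w ≡ Q · a ⊕ P · b
farey-decomposition {a₁ , a₂} {b₁ , b₂} {w₁ , w₂} {P} {Q} (adjacent adj) hP hQ =
  sym (cong₂ _,_ (+-cancelʳ-≡ _ _ _ first) (+-cancelʳ-≡ _ _ _ second))
  where
  open ≡-Reasoning
  first : Q * a₁ + P * b₁ + (a₁ * (w₂ * b₁) + b₁ * (a₂ * w₁)) ≡ w₁ + (a₁ * (w₂ * b₁) + b₁ * (a₂ * w₁))
  first = begin
    Q * a₁ + P * b₁ + (a₁ * (w₂ * b₁) + b₁ * (a₂ * w₁)) ≡⟨ solve (Q ∷ a₁ ∷ P ∷ b₁ ∷ w₂ ∷ a₂ ∷ w₁ ∷ []) ⟩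
    a₁ * (w₂ * b₁ + Q) + b₁ * (a₂ * w₁ + P)             ≡⟨ cong₂ (λ s t → a₁ * s + b₁ * t) hQ hP ⟩
    a₁ * (b₂ * w₁) + b₁ * (w₂ * a₁)                     ≡⟨ solve (a₁ ∷ b₂ ∷ w₁ ∷ b₁ ∷ w₂ ∷ []) ⟩
    w₁ * (a₁ * b₂) + a₁ * (w₂ * b₁)                     ≡⟨ cong (λ t → w₁ * t + a₁ * (w₂ * b₁)) adj ⟩
    w₁ * (1 + a₂ * b₁) + a₁ * (w₂ * b₁)                 ≡⟨ solve (w₁ ∷ a₂ ∷ b₁ ∷ a₁ ∷ w₂ ∷ []) ⟩
    w₁ + (a₁ * (w₂ * b₁) + b₁ * (a₂ * w₁))              ∎
  second : Q * a₂ + P * b₂ + (a₂ * (w₂ * b₁) + b₂ * (a₂ * w₁)) ≡ w₂ + (a₂ * (w₂ * b₁) + b₂ * (a₂ * w₁))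
  second = begin
    Q * a₂ + P * b₂ + (a₂ * (w₂ * b₁) + b₂ * (a₂ * w₁)) ≡⟨ solve (Q ∷ a₂ ∷ P ∷ b₂ ∷ w₂ ∷ b₁ ∷ w₁ ∷ []) ⟩
    a₂ * (w₂ * b₁ + Q) + b₂ * (a₂ * w₁ + P)             ≡⟨ cong₂ (λ s t → a₂ * s + b₂ * t) hQ hP ⟩
    a₂ * (b₂ * w₁) + b₂ * (w₂ * a₁)                     ≡⟨ solve (a₂ ∷ b₂ ∷ w₁ ∷ w₂ ∷ a₁ ∷ []) ⟩
    w₂ * (a₁ * b₂) + a₂ * (b₂ * w₁)                     ≡⟨ cong (λ t → w₂ * t + a₂ * (b₂ * w₁)) adj ⟩
    w₂ * (1 + a₂ * b₁) + a₂ * (b₂ * w₁)                 ≡⟨ solve (w₂ ∷ a₂ ∷ b₁ ∷ b₂ ∷ w₁ ∷ []) ⟩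
    w₂ + (a₂ * (w₂ * b₁) + b₂ * (a₂ * w₁))              ∎

weight-decomposition : ∀ {a b w P Q} → Adjacent a b →
                       proj₂ a * proj₁ w + P ≡ proj₂ w * proj₁ a →
                       proj₂ w * proj₁ b + Q ≡ proj₂ b * proj₁ w →
                       weight w ≡ Q * weight a + P * weight b
weight-decomposition {a} {b} {w} {P} {Q} adj hP hQ = begin
  weight w                      ≡⟨ cong weight (farey-decomposition {a} {b} {w} adj hP hQ) ⟩
  weight (Q · a ⊕ P · b)        ≡⟨ weight-⊕ (Q · a) (P · b) ⟩
  weight (Q · a) + weight (P · b) ≡⟨ cong₂ _+_ (weight-· Q a) (weight-· P b) ⟩
  Q * weight a + P * weight b   ∎
  where open ≡-Reasoning

weight-between : ∀ {a b} w → Adjacent a b → a ≺ w → w ≺ b → weight a + weight b ≤ weight w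
weight-between {a} {b} w adj a≺w w≺b
  with P , hP ← <⇒+suc≡ a≺w | Q , hQ ← <⇒+suc≡ w≺b =
  subst (weight a + weight b ≤_) (sym (weight-decomposition {a} {b} {w} adj hP hQ))
        (+-mono-≤ (m≤m+n (weight a) _) (m≤m+n (weight b) _))

weight-≥ˡ : ∀ {a b} w → Adjacent a b → a ≼ w → w ≺ b → weight a ≤ weight w
weight-≥ˡ {a} {b} w adj a≼w w≺b
  with P , hP ← m≤n⇒∃[o]m+o≡n a≼w | Q , hQ ← <⇒+suc≡ w≺b =
  subst (weight a ≤_) (sym (weight-decomposition {a} {b} {w} adj hP hQ))
        (≤-trans (m≤m+n (weight a) _) (m≤m+n _ (P * weight b)))

weight-≥ʳ : ∀ {a b} w → Adjacent a b → a ≺ w → w ≼ b → weight b ≤ weight w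
weight-≥ʳ {a} {b} w adj a≺w w≼b
  with P , hP ← <⇒+suc≡ a≺w | Q , hQ ← m≤n⇒∃[o]m+o≡n w≼b =
  subst (weight b ≤_) (sym (weight-decomposition {a} {b} {w} adj hP hQ))
        (≤-trans (m≤m+n (weight b) _) (m≤n+m _ (Q * weight a)))

parallel⇒multipleˡ : ∀ {a b} w → Adjacent a b → Parallel a w → w ≺ b → ∃ λ k → w ≡ suc k · a
parallel⇒multipleˡ {a} {b} w adj a∥w w≺b with Q , hQ ← <⇒+suc≡ w≺b =
  Q , trans (farey-decomposition {a} {b} {w} adj (trans (+-identityʳ _) a∥w) hQ) (⊕-identityʳ (suc Q · a))

parallel⇒multipleʳ : ∀ {a b} w → Adjacent a b → a ≺ w → Parallel w b → ∃ λ k → w ≡ suc k · b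
parallel⇒multipleʳ {a} {b} w adj a≺w w∥b with P , hP ← <⇒+suc≡ a≺w =
  P , farey-decomposition {a} {b} {w} adj hP (trans (+-identityʳ _) w∥b)

left-neighbour-unique : ∀ {a a' v} → Adjacent a v → Adjacent a' v →
                        weight a < weight v → weight a' < weight v → a ≡ a'
left-neighbour-unique {a} {a'} adj adj' a<v a'<v with ≺-compare a a'
... | tri< a≺a' _ _ = ⊥-elim (<⇒≱ a'<v (m+n≤o⇒n≤o (weight a) (weight-between a' adj a≺a' (adjacent⇒≺ adj'))))
... | tri> _ _ a'≺a = ⊥-elim (<⇒≱ a<v (m+n≤o⇒n≤o (weight a') (weight-between a adj' a'≺a (adjacent⇒≺ adj))))
... | tri≈ _ a∥a' _ with k , refl ← parallel⇒multipleˡ a' adj a∥a' (adjacent⇒≺ adj')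
                    with refl ← adjacent-multiple {suc k} adj adj' = sym (·-identityˡ a)

right-neighbour-lightest : ∀ {a b q} → Adjacent a q → weight q < weight a → Adjacent a b → weight q ≤ weight b
right-neighbour-lightest {a} {b} {q} adjq q<a adjb with ≺-or-≽ q b
... | inj₁ q≺b = ⊥-elim (<⇒≱ q<a (m+n≤o⇒m≤o (weight a) (weight-between q adjb (adjacent⇒≺ adjq) q≺b)))
... | inj₂ b≼q = weight-≥ʳ b adjq (adjacent⇒≺ adjb) b≼q

left-neighbour-lightest : ∀ {a b p} → Adjacent p b → weight p < weight b → Adjacent a b → weight p ≤ weight a
left-neighbour-lightest {a} {p = p} adjp p<b adja with ≺-or-≽ a p
... | inj₁ a≺p = ⊥-elim (<⇒≱ p<b (m+n≤o⇒n≤o (weight a) (weight-between p adja a≺p (adjacent⇒≺ adjp))))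
... | inj₂ p≼a = weight-≥ˡ a adjp p≼a (adjacent⇒≺ adja)

split-adjacent : ∀ {v a b} → Split v a b → Adjacent a b
split-adjacent (_ , _ , _ , det) = adjacent det

split-adjacentˡ : ∀ {v a b} → Split v a b → Adjacent a v
split-adjacentˡ (_ , _ , refl , det) = adjacent-mediantˡ (adjacent det)

split-adjacentʳ : ∀ {v a b} → Split v a b → Adjacent v b
split-adjacentʳ (_ , _ , refl , det) = adjacent-mediantʳ (adjacent det)

split-Qpos : ∀ {v a b} → Split v a b → Qpos v
split-Qpos sp@(_ , _ , refl , _) = mediant-Qpos (split-adjacent sp)

split-weight : ∀ {v a b} → Split v a b → weight v ≡ weight a + weight b
split-weight {a = a} {b} (_ , _ , refl , _) = weight-⊕ a b

split-weightˡ< : ∀ {v a b} → Split v a b → weight a < weight v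
split-weightˡ< {a = a} sp =
  subst (weight a <_) (sym (split-weight sp)) (m<m+n (weight a) (adjacent⇒weightʳ>0 (split-adjacent sp)))

split-weightʳ< : ∀ {v a b} → Split v a b → weight b < weight v
split-weightʳ< {b = b} sp =
  subst (weight b <_) (sym (split-weight sp)) (m<n+m (weight b) (adjacent⇒weightˡ>0 (split-adjacent sp)))

split-unique : ∀ {v a b a' b'} → Split v a b → Split v a' b' → a ≡ a' × b ≡ b'
split-unique {a = a} sp@(_ , _ , v≡ , _) sp'@(_ , _ , v≡' , _)
  with refl ← left-neighbour-unique (split-adjacentˡ sp) (split-adjacentˡ sp')
                                    (split-weightˡ< sp) (split-weightˡ< sp') =
  refl , ⊕-cancelˡ a (trans (sym v≡) v≡')

all-splits : ∀ {v a b} (P : Pt → Pt → Set) → Split v a b → P a b → ∀ a' b' → Split v a' b' → P a' b'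
all-splits P sp p a' b' sp' with refl , refl ← split-unique sp sp' = p

split-childʳ : ∀ {v a b} → Split v a b → Split (v ⊕ b) v b
split-childʳ sp@(_ , qb , refl , _) = inj₁ (mediant-Qpos (split-adjacent sp)) , qb , refl , Adjacent.det (split-adjacentʳ sp)

split-childˡ : ∀ {v a b} → Split v a b → Split (v ⊕ a) a v
split-childˡ {a = a} sp@(qa , _ , refl , _) =
  qa , inj₁ (mediant-Qpos (split-adjacent sp)) , ⊕-comm _ a , Adjacent.det (split-adjacentˡ sp)

parents-outweigh : ∀ {l r z p q} → Adjacent l r → l ≺ z → z ≺ r → Split z p q →
                   weight l ≤ weight p × weight r ≤ weight q
parents-outweigh {l} {r} {z} {p} {q} adj l≺z z≺r sp = left , right
  where
  p≺z = adjacent⇒≺ (split-adjacentˡ sp)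
  z≺q = adjacent⇒≺ (split-adjacentʳ sp)
  lr≤pq : weight l + weight r ≤ weight p + weight q
  lr≤pq = subst (weight l + weight r ≤_) (split-weight sp) (weight-between z adj l≺z z≺r)
  pq≤ : ∀ {t} → p ≺ t → t ≺ q → weight p + weight q ≤ weight t
  pq≤ {t} = weight-between t (split-adjacent sp)
  left : weight l ≤ weight p
  left with ≺-or-≽ p l
  ... | inj₁ p≺l = ⊥-elim (<⇒≱ (m<m+n (weight l) (adjacent⇒weightʳ>0 adj))
                                (≤-trans lr≤pq (pq≤ p≺l (≺-trans {l} {z} {q} l≺z z≺q))))
  ... | inj₂ l≼p = weight-≥ˡ p adj l≼p (≺-trans {p} {z} {r} p≺z z≺r)
  right : weight r ≤ weight q
  right with ≺-or-≽ r q
  ... | inj₁ r≺q = ⊥-elim (<⇒≱ (m<n+m (weight r) (adjacent⇒weightˡ>0 adj))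
                                (≤-trans lr≤pq (pq≤ (≺-trans {p} {z} {r} p≺z z≺r) r≺q)))
  ... | inj₂ q≼r = weight-≥ʳ q adj (≺-trans {l} {z} {q} l≺z z≺q) q≼r

-- Existence of splits

shearˣ : Pt → Pt
shearˣ (x , y) = (y + x , y)

shearʸ : Pt → Pt
shearʸ (x , y) = (x , x + y)

coprime-unshearˣ : ∀ {x y} → Coprime (y + x) y → Coprime x y
coprime-unshearˣ c (d∣x , d∣y) = c (∣m∣n⇒∣m+n d∣y d∣x , d∣y)

coprime-unshearʸ : ∀ {x y} → Coprime x (x + y) → Coprime x y
coprime-unshearʸ c (d∣x , d∣y) = c (d∣x , ∣m∣n⇒∣m+n d∣x d∣y)

shearˣ-Qext : ∀ {a} → Qext a → Qext (shearˣ a)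
shearˣ-Qext {x , y} (inj₁ (1≤x , 1≤y , g)) =
  inj₁ (≤-trans 1≤x (m≤n+m x y) , 1≤y , coprime⇒gcd≡1 (coprime-+ (gcd≡1⇒coprime {x} {y} g)))
shearˣ-Qext (inj₂ (inj₁ refl)) = inj₂ (inj₁ refl)
shearˣ-Qext (inj₂ (inj₂ refl)) = inj₁ (s≤s z≤n , s≤s z≤n , refl)

shearʸ-Qext : ∀ {a} → Qext a → Qext (shearʸ a)
shearʸ-Qext {x , y} (inj₁ (1≤x , 1≤y , g)) =
  inj₁ (1≤x , ≤-trans 1≤y (m≤n+m y x) , coprime⇒gcd≡1 (coprime-sym (coprime-+ (coprime-sym (gcd≡1⇒coprime {x} {y} g)))))
shearʸ-Qext (inj₂ (inj₁ refl)) = inj₁ (s≤s z≤n , s≤s z≤n , refl)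
shearʸ-Qext (inj₂ (inj₂ refl)) = inj₂ (inj₂ refl)

shearˣ-adjacent : ∀ {a b} → Adjacent a b → Adjacent (shearˣ a) (shearˣ b)
shearˣ-adjacent {a₁ , a₂} {b₁ , b₂} (adjacent adj) = adjacent (begin
  (a₂ + a₁) * b₂          ≡⟨ solve (a₂ ∷ a₁ ∷ b₂ ∷ []) ⟩
  a₁ * b₂ + a₂ * b₂       ≡⟨ cong (_+ a₂ * b₂) adj ⟩
  1 + a₂ * b₁ + a₂ * b₂   ≡⟨ solve (a₂ ∷ b₁ ∷ b₂ ∷ []) ⟩
  1 + a₂ * (b₂ + b₁)      ∎)
  where open ≡-Reasoning

shearʸ-adjacent : ∀ {a b} → Adjacent a b → Adjacent (shearʸ a) (shearʸ b)
shearʸ-adjacent {a₁ , a₂} {b₁ , b₂} (adjacent adj) = adjacent (begin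
  a₁ * (b₁ + b₂)          ≡⟨ *-distribˡ-+ a₁ b₁ b₂ ⟩
  a₁ * b₁ + a₁ * b₂       ≡⟨ cong (a₁ * b₁ +_) adj ⟩
  a₁ * b₁ + (1 + a₂ * b₁) ≡⟨ solve (a₁ ∷ b₁ ∷ a₂ ∷ []) ⟩
  1 + (a₁ + a₂) * b₁      ∎)
  where open ≡-Reasoning

shearˣ-split : ∀ {v a b} → Split v a b → Split (shearˣ v) (shearˣ a) (shearˣ b)
shearˣ-split {a = a₁ , a₂} {b₁ , b₂} sp@(qa , qb , refl , _) =
  shearˣ-Qext qa , shearˣ-Qext qb , cong (_, a₂ + b₂) (+-interchange a₂ b₂ a₁ b₁) , Adjacent.det (shearˣ-adjacent (split-adjacent sp))

shearʸ-split : ∀ {v a b} → Split v a b → Split (shearʸ v) (shearʸ a) (shearʸ b)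
shearʸ-split {a = a₁ , a₂} {b₁ , b₂} sp@(qa , qb , refl , _) =
  shearʸ-Qext qa , shearʸ-Qext qb , cong (a₁ + b₁ ,_) (+-interchange a₁ b₁ a₂ b₂) , Adjacent.det (shearʸ-adjacent (split-adjacent sp))

m+n≤1+k⇒n≤k : ∀ {m n k} → 1 ≤ m → m + n ≤ suc k → n ≤ k
m+n≤1+k⇒n≤k {n = n} 1≤m m+n≤ = ≤-pred (≤-trans (+-monoˡ-≤ n 1≤m) m+n≤)

-- Euclid's algorithm; the fuel k bounds x + y.
split-exists′ : ∀ k {x y} → x + y ≤ k → 1 ≤ x → 1 ≤ y → Coprime x y →
                Σ Pt λ a → Σ Pt λ b → Split (x , y) a b
split-exists′ zero {suc _} () _ _ _
split-exists′ (suc k) {x} {y} x+y≤ 1≤x 1≤y cop with <-cmp x y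
... | tri≈ _ refl _ with refl ← cop (∣-refl , ∣-refl) =
  0̲ , ∞̲ , inj₂ (inj₁ refl) , inj₂ (inj₂ refl) , refl , refl
... | tri< x<y _ _ with d , refl ← <⇒+suc≡ x<y
  with a , b , sp ← split-exists′ k (m+n≤1+k⇒n≤k 1≤x x+y≤) 1≤x (s≤s z≤n) (coprime-unshearʸ cop) =
  shearʸ a , shearʸ b , shearʸ-split sp
... | tri> _ _ y<x with d , refl ← <⇒+suc≡ y<x
  with a , b , sp ← split-exists′ k (m+n≤1+k⇒n≤k 1≤y (≤-trans (≤-reflexive (sym (+-assoc y (suc d) y))) x+y≤))
                                  (s≤s z≤n) 1≤y (coprime-unshearˣ cop) =
  shearˣ a , shearˣ b , shearˣ-split sp

split-exists : ∀ v → Qpos v → Σ Pt λ a → Σ Pt λ b → Split v a b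
split-exists (x , y) (1≤x , 1≤y , g) = split-exists′ (x + y) ≤-refl 1≤x 1≤y (gcd≡1⇒coprime g)

IsPred-unique : ∀ {c : PSet} {m v u} → (∀ z → c z → Qpos z) → Qext m → Adjacent m v → (c m ⊎ m ≡ 0̲) →
                (∀ z → c z → ¬ (m ≺ z × z ≺ v)) → IsPred c u v → u ≡ m
IsPred-unique {m = m} {u = u} c⊆Qpos qm adj m∈ gap (u∈ , u≺v , u-gap) with ≺-compare u m | m∈ | u∈
... | tri< u≺m _ _ | inj₁ m∈c | _       = ⊥-elim (u-gap m m∈c (u≺m , adjacent⇒≺ adj))
... | tri< u≺m _ _ | inj₂ refl | _      = ⊥-elim (≺0̲-empty u u≺m)
... | tri> _ _ m≺u | _ | inj₁ u∈c       = ⊥-elim (gap u u∈c (m≺u , u≺v))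
... | tri> _ _ m≺u | _ | inj₂ refl      = ⊥-elim (≺0̲-empty m m≺u)
... | tri≈ _ u∥m _ | _ | inj₂ refl      = sym (Qext-horizontal qm (sym (trans u∥m (*-identityʳ _))))
... | tri≈ _ u∥m _ | _ | inj₁ u∈c
  with k , refl ← parallel⇒multipleˡ u adj (sym u∥m) u≺v = primitive-multiple (suc k) m (proj₂ (proj₂ (c⊆Qpos _ u∈c)))

IsSucc-unique : ∀ {c : PSet} {m v w} → (∀ z → c z → Qpos z) → Qext m → Adjacent v m → (c m ⊎ m ≡ ∞̲) →
                (∀ z → c z → ¬ (v ≺ z × z ≺ m)) → IsSucc c v w → w ≡ m
IsSucc-unique {m = m} {w = w} c⊆Qpos qm adj m∈ gap (w∈ , v≺w , w-gap) with ≺-compare w m | m∈ | w∈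
... | tri< w≺m _ _ | _ | inj₁ w∈c       = ⊥-elim (gap w w∈c (v≺w , w≺m))
... | tri< w≺m _ _ | _ | inj₂ refl      = ⊥-elim (∞̲≺-empty m w≺m)
... | tri> _ _ m≺w | inj₁ m∈c | _       = ⊥-elim (w-gap m m∈c (adjacent⇒≺ adj , m≺w))
... | tri> _ _ m≺w | inj₂ refl | _      = ⊥-elim (∞̲≺-empty w m≺w)
... | tri≈ _ w∥m _ | _ | inj₂ refl      = sym (Qext-vertical qm (trans (sym (+-identityʳ _)) (trans w∥m (*-zeroʳ (proj₂ m)))))
... | tri≈ _ w∥m _ | _ | inj₁ w∈c
  with k , refl ← parallel⇒multipleʳ w adj v≺w w∥m = primitive-multiple (suc k) m (proj₂ (proj₂ (c⊆Qpos _ w∈c)))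

-- The iterates of Φ on a ball

module _ (N : ℕ) where

  Fits : ℕ → ℕ → ℕ → Set
  Fits zero    α β = α + β ≤ N
  Fits (suc n) α β = Fits n α β × Fits n α (α + β) × Fits n (α + β) β

  Fits-antitone : ∀ n {α β α' β'} → α' ≤ α → β' ≤ β → Fits n α β → Fits n α' β'
  Fits-antitone zero α'≤α β'≤β f = ≤-trans (+-mono-≤ α'≤α β'≤β) f
  Fits-antitone (suc n) α'≤α β'≤β (f , fˡ , fʳ) =
    Fits-antitone n α'≤α β'≤β f , Fits-antitone n α'≤α sum≤ fˡ , Fits-antitone n sum≤ β'≤β fʳ
    where sum≤ = +-mono-≤ α'≤α β'≤β

  fits? : ∀ n α β → Dec (Fits n α β)
  fits? zero    α β = α + β ≤? N
  fits? (suc n) α β = fits? n α β ×-dec fits? n α (α + β) ×-dec fits? n (α + β) β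

  ΦBall : ℕ → PSet
  ΦBall n = Φ^ n (Ball N)

  ΦBall⊆Ball : ∀ n v → ΦBall n v → Ball N v
  ΦBall⊆Ball zero    v v∈ = v∈
  ΦBall⊆Ball (suc n) v v∈ = ΦBall⊆Ball n v (proj₁ v∈)

  ΦBall⊆Qpos : ∀ n v → ΦBall n v → Qpos v
  ΦBall⊆Qpos n v = proj₁ ∘ ΦBall⊆Ball n v

  ΦBall⇔Fits : ∀ n {v a b} → Split v a b → ΦBall n v ⇔ Fits n (weight a) (weight b)
  ΦBall⇔Fits zero sp =
    mk⇔ (λ v∈ → subst (_≤ N) (split-weight sp) (proj₂ v∈))
        (λ f → split-Qpos sp , subst (_≤ N) (sym (split-weight sp)) f)
  ΦBall⇔Fits (suc n) {v} {a} {b} sp = mk⇔ fits-of-member member-of-fits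
    where
    childˡ = ΦBall⇔Fits n (split-childˡ sp)
    childʳ = ΦBall⇔Fits n (split-childʳ sp)
    wv≡ = split-weight sp
    fits-of-member : ΦBall (suc n) v → Fits (suc n) (weight a) (weight b)
    fits-of-member (v∈ , children) =
        to (ΦBall⇔Fits n sp) v∈
      , subst (Fits n (weight a)) wv≡ (to childˡ (proj₂ (children a b sp)))
      , subst (λ t → Fits n t (weight b)) wv≡ (to childʳ (proj₁ (children a b sp)))
    member-of-fits : Fits (suc n) (weight a) (weight b) → ΦBall (suc n) v
    member-of-fits (f , fˡ , fʳ) =
        from (ΦBall⇔Fits n sp) f
      , all-splits (λ a' b' → ΦBall n (v ⊕ b') × ΦBall n (v ⊕ a')) sp
          ( from childʳ (subst (λ t → Fits n t (weight b)) (sym wv≡) fʳ)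
          , from childˡ (subst (Fits n (weight a)) (sym wv≡) fˡ))

  ΦBall? : ∀ n {v a b} → Split v a b → Dec (ΦBall n v)
  ΦBall? n sp = map′ (from (ΦBall⇔Fits n sp)) (to (ΦBall⇔Fits n sp)) (fits? n _ _)

  ΦBall-parent : ∀ n {u v} → Child u v → ΦBall n v → ΦBall n u
  ΦBall-parent n (a , b , sp , inj₁ refl) v∈ =
    from (ΦBall⇔Fits n sp)
      (Fits-antitone n (<⇒≤ (split-weightˡ< sp)) ≤-refl (to (ΦBall⇔Fits n (split-childʳ sp)) v∈))
  ΦBall-parent n (a , b , sp , inj₂ refl) v∈ =
    from (ΦBall⇔Fits n sp)
      (Fits-antitone n ≤-refl (<⇒≤ (split-weightʳ< sp)) (to (ΦBall⇔Fits n (split-childˡ sp)) v∈))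

  ΦBall-⊲-closed : ∀ n {u v} → u ⊲ v → ΦBall n v → ΦBall n u
  ΦBall-⊲-closed n ⊲-refl v∈ = v∈
  ΦBall-⊲-closed n (⊲-step u⊲w child) v∈ = ΦBall-⊲-closed n u⊲w (ΦBall-parent n child v∈)

  Ball-finite : Finite (Ball N)
  Ball-finite = cartesianProduct (upTo (suc N)) (upTo (suc N)) , λ where
    (x , y) (_ , x+y≤N) → ∈-cartesianProduct⁺ (∈-upTo⁺ (s≤s (m+n≤o⇒m≤o x x+y≤N)))
                                               (∈-upTo⁺ (s≤s (m+n≤o⇒n≤o x x+y≤N)))

  ΦBall-lhd : ∀ n → IsLhdSet (ΦBall n)
  ΦBall-lhd n = (proj₁ Ball-finite , λ v v∈ → proj₂ Ball-finite v (ΦBall⊆Ball n v v∈))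
              , ΦBall⊆Qpos n
              , λ v v' v∈ v'⊲v → ΦBall-⊲-closed n v'⊲v v∈

  no-point-between : ∀ n {l r} → Adjacent l r → ¬ Fits n (weight l) (weight r) →
                     ∀ z → ΦBall n z → ¬ (l ≺ z × z ≺ r)
  no-point-between n adj ¬fits z z∈ (l≺z , z≺r) with p , q , sp ← split-exists z (ΦBall⊆Qpos n z z∈) =
    let l≤p , r≤q = parents-outweigh adj l≺z z≺r sp in
    ¬fits (Fits-antitone n l≤p r≤q (to (ΦBall⇔Fits n sp) z∈))

  left-neighbour-member : ∀ n {a b} → Adjacent a b → Qext a → Fits n (weight a) (weight b) → ΦBall n a ⊎ a ≡ 0̲
  left-neighbour-member n adj (inj₂ (inj₁ a≡0̲)) _ = inj₂ a≡0̲
  left-neighbour-member n (adjacent ()) (inj₂ (inj₂ refl)) _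
  left-neighbour-member n adj (inj₁ qa) f with p , q , sp ← split-exists _ qa =
    inj₁ (from (ΦBall⇔Fits n sp)
           (Fits-antitone n (<⇒≤ (split-weightˡ< sp))
                            (right-neighbour-lightest (split-adjacentʳ sp) (split-weightʳ< sp) adj) f))

  right-neighbour-member : ∀ n {a b} → Adjacent a b → Qext b → Fits n (weight a) (weight b) → ΦBall n b ⊎ b ≡ ∞̲
  right-neighbour-member n adj (inj₂ (inj₁ refl)) _ = ⊥-elim (<⇒≢ (adjacent⇒1≤ʳ adj) refl)
  right-neighbour-member n adj (inj₂ (inj₂ b≡∞̲)) _ = inj₂ b≡∞̲
  right-neighbour-member n adj (inj₁ qb) f with p , q , sp ← split-exists _ qb =
    inj₁ (from (ΦBall⇔Fits n sp)
           (Fits-antitone n (left-neighbour-lightest (split-adjacentˡ sp) (split-weightˡ< sp) adj)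
                            (<⇒≤ (split-weightʳ< sp)) f))

  Midpoint : ℕ → Pt → Set
  Midpoint n v = ∀ u w → IsPred (ΦBall n) u v → IsSucc (ΦBall n) v w → v ⊕ v ≡ u ⊕ w

  only-right-child⇒midpoint : ∀ n {v a b} → Split v a b → ΦBall n v →
                              ΦBall n (v ⊕ b) → ¬ ΦBall n (v ⊕ a) → Midpoint n v
  only-right-child⇒midpoint n {v} {a} {b} sp@(qa , _ , v≡a⊕b , _) v∈ vb∈ va∉ u w u-pred w-succ =
    trans (⊕-equal-stepsʳ {v} {a} {b} v≡a⊕b) (sym (cong₂ _⊕_ u≡a w≡vb))
    where
    ¬fitsˡ : ¬ Fits n (weight a) (weight v)
    ¬fitsˡ = va∉ ∘ from (ΦBall⇔Fits n (split-childˡ sp))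
    adjʳ : Adjacent v (v ⊕ b)
    adjʳ = split-adjacentˡ (split-childʳ sp)
    ¬fitsʳ : ¬ Fits n (weight v) (weight (v ⊕ b))
    ¬fitsʳ = ¬fitsˡ ∘ Fits-antitone n (<⇒≤ (split-weightˡ< sp)) (<⇒≤ (split-weightˡ< (split-childʳ sp)))
    u≡a : u ≡ a
    u≡a = IsPred-unique (ΦBall⊆Qpos n) qa (split-adjacentˡ sp)
            (left-neighbour-member n (split-adjacent sp) qa (to (ΦBall⇔Fits n sp) v∈))
            (no-point-between n (split-adjacentˡ sp) ¬fitsˡ) u-pred
    w≡vb : w ≡ v ⊕ b
    w≡vb = IsSucc-unique (ΦBall⊆Qpos n) (inj₁ (ΦBall⊆Qpos n _ vb∈)) adjʳ (inj₁ vb∈)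
             (no-point-between n adjʳ ¬fitsʳ) w-succ

  only-left-child⇒midpoint : ∀ n {v a b} → Split v a b → ΦBall n v →
                             ¬ ΦBall n (v ⊕ b) → ΦBall n (v ⊕ a) → Midpoint n v
  only-left-child⇒midpoint n {v} {a} {b} sp@(_ , qb , v≡a⊕b , _) v∈ vb∉ va∈ u w u-pred w-succ =
    trans (⊕-equal-stepsˡ {v} {a} {b} v≡a⊕b) (sym (cong₂ _⊕_ u≡va w≡b))
    where
    ¬fitsʳ : ¬ Fits n (weight v) (weight b)
    ¬fitsʳ = vb∉ ∘ from (ΦBall⇔Fits n (split-childʳ sp))
    adjˡ : Adjacent (v ⊕ a) v
    adjˡ = split-adjacentʳ (split-childˡ sp)
    ¬fitsˡ : ¬ Fits n (weight (v ⊕ a)) (weight v)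
    ¬fitsˡ = ¬fitsʳ ∘ Fits-antitone n (<⇒≤ (split-weightʳ< (split-childˡ sp))) (<⇒≤ (split-weightʳ< sp))
    w≡b : w ≡ b
    w≡b = IsSucc-unique (ΦBall⊆Qpos n) qb (split-adjacentʳ sp)
            (right-neighbour-member n (split-adjacent sp) qb (to (ΦBall⇔Fits n sp) v∈))
            (no-point-between n (split-adjacentʳ sp) ¬fitsʳ) w-succ
    u≡va : u ≡ v ⊕ a
    u≡va = IsPred-unique (ΦBall⊆Qpos n) (inj₁ (ΦBall⊆Qpos n _ va∈)) adjˡ (inj₁ va∈)
             (no-point-between n adjˡ ¬fitsˡ) u-pred

  ΦBall-star : ∀ n v → ΦBall n v → Cmax (ΦBall n) v ⊎ Φ (ΦBall n) v ⊎ Midpoint n v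
  ΦBall-star n v v∈ with a , b , sp ← split-exists v (ΦBall⊆Qpos n v v∈)
                     | ΦBall? n (split-childʳ sp) | ΦBall? n (split-childˡ sp)
  ... | yes vb∈ | yes va∈ = inj₂ (inj₁ (v∈ , all-splits (λ a' b' → ΦBall n (v ⊕ b') × ΦBall n (v ⊕ a')) sp (vb∈ , va∈)))
  ... | no vb∉  | no va∉  = inj₁ (v∈ , all-splits (λ a' b' → ¬ ΦBall n (v ⊕ b') × ¬ ΦBall n (v ⊕ a')) sp (vb∉ , va∉))
  ... | yes vb∈ | no va∉  = inj₂ (inj₂ (only-right-child⇒midpoint n sp v∈ vb∈ va∉))
  ... | no vb∉  | yes va∈ = inj₂ (inj₂ (only-left-child⇒midpoint n sp v∈ vb∉ va∈))

-- Every ball is a corona; the bound 2 ≤ N only excludes the empty ones.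
mainTheorem2 : (N : ℕ) → 2 ≤ N → IsCorona (Ball N)
mainTheorem2 N _ = ΦBall-lhd N 0 , λ n → ΦBall-lhd N n , ΦBall-star N n
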